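{- For every integer $n\ge1$, $$P_n(t;X_n)=\sum_{i=1}^{n}x_{i,1}^{0}x_{i,2}^{1}\cdots x_{i,i}^{i-1}\cdot P_{n-1}\big(t;R_1(X_n,i)\big).$$
   Context: For $\pi\in\mathcal S_m$, $N_{231}(\pi)$ is the number of index triples $a<b<c$ with $\pi_c<\pi_a<\pi_b$. With variables $t$ and $x_{i,j}$ ($1\le j\le i$), let $$\mathrm{weight}(\pi)=t^{N_{231}(\pi)}\prod_{1\le j\le i\le m}x_{i,j}^{\#\{(a,b):\,1\le a<b\le m,\ \pi_a=i,\ \pi_b<j\}},$$ and $P_m(t;X_m)=\sum_{\pi\in\mathcal S_m}\mathrm{weight}(\pi)$, where $X_m=(x_{i,j})_{1\le i,j\le m}$ is the $m\times m$ matrix of variables (entries above the diagonal are ignored); $\mathcal S_0$ consists of the empty permutation, so $P_0=1$. For an $(m)\times(m)$ matrix $M$ (entries in a commutative ring), $P_m(t;M)$ denotes $P_m$ with $x_{b,c}$ replaced by $M_{b,c}$ for all $1\le c\le b\le m$. For an $n\times n$ matrix $M$ and $1\le i<n$, $R_1(M,i)$ is the $(n-1)\times(n-1)$ matrix whose $(b,c)$ entry is: $M_{b',c}$ if $c<i$, $t\,M_{b',i}M_{b',i+1}$ if $c=i$, $M_{b',c+1}$ if $c>i$, where $b'=b$ if $b<i$ and $b'=b+1$ if $b\ge i$ (i.e. delete row $i$, merge columns $i$ and $i+1$ by entrywise product and multiply that column by $t$). For $i=n$, $R_1(M,n)$ is $M$ with its $n$-th row and $n$-th column deleted. -}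

module Defs where

open import Data.Nat using (ℕ; zero; suc; _<ᵇ_; _≡ᵇ_; _≤ᵇ_)
open import Data.Fin using (Fin; zero; suc; toℕ; punchIn; inject₁)
open import Data.List using (List; []; _∷_; map; concatMap; foldr)
open import Data.Nat.ListAction using () renaming (sum to sumℕ)
open import Data.Bool using (Bool; true; false; if_then_else_; _∧_; _∨_; not)
open import Algebra.Bundles using (CommutativeRing)

allFin : (n : ℕ) → List (Fin n)
allFin zero = []
allFin (suc n) = zero ∷ map suc (allFin n)

consF : ∀ {m k} → Fin k → (Fin m → Fin k) → Fin (suc m) → Fin k
consF v f zero = v
consF v f (suc a) = f a

allFuns : (m k : ℕ) → List (Fin m → Fin k)
allFuns zero k = (λ ()) ∷ []
allFuns (suc m) k = concatMap (λ f → map (λ v → consF v f) (allFin k)) (allFuns m k)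

_<F_ : ∀ {n k} → Fin n → Fin k → Bool
a <F b = toℕ a <ᵇ toℕ b

_=F_ : ∀ {n k} → Fin n → Fin k → Bool
a =F b = toℕ a ≡ᵇ toℕ b

_≤F_ : ∀ {n k} → Fin n → Fin k → Bool
a ≤F b = toℕ a ≤ᵇ toℕ b

count : ∀ {n} → (Fin n → Bool) → ℕ
count {n} p = sumℕ (map (λ a → if p a then 1 else 0) (allFin n))

allB : ∀ {n} → (Fin n → Bool) → Bool
allB {n} p = foldr _∧_ true (map p (allFin n))

-- injective maps Fin m → Fin m, i.e. permutations in S_m (π_a = π a, 0-based)
isPerm : ∀ {m} → (Fin m → Fin m) → Bool
isPerm π = allB (λ a → allB (λ b → not (π a =F π b) ∨ (a =F b)))

count2 : ∀ {n} → (Fin n → Fin n → Bool) → ℕ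
count2 {n} p = sumℕ (map (λ a → count (p a)) (allFin n))

count3 : ∀ {n} → (Fin n → Fin n → Fin n → Bool) → ℕ
count3 {n} p = sumℕ (map (λ a → count2 (p a)) (allFin n))

N231 : ∀ {m} → (Fin m → Fin m) → ℕ
N231 π = count3 (λ a b c → (a <F b) ∧ (b <F c) ∧ (π c <F π a) ∧ (π a <F π b))

-- exponent of x_{i,j}: #{(a,b) : a<b, π_a = i, π_b < j}   (0-based indices)
expo : ∀ {m} → (Fin m → Fin m) → Fin m → Fin m → ℕ
expo π i j = count2 (λ a b → (a <F b) ∧ (π a =F i) ∧ (π b <F j))

module WithRing {c ℓ} (R : CommutativeRing c ℓ) where
  open CommutativeRing R

  infixr 8 _^_
  _^_ : Carrier → ℕ → Carrier
  x ^ zero = 1#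
  x ^ suc n = x * (x ^ n)

  sumL : List Carrier → Carrier
  sumL = foldr _+_ 0#

  prodL : List Carrier → Carrier
  prodL = foldr _*_ 1#

  ΣF : ∀ {n} → (Fin n → Carrier) → Carrier
  ΣF {n} f = sumL (map f (allFin n))

  ΠF : ∀ {n} → (Fin n → Carrier) → Carrier
  ΠF {n} f = prodL (map f (allFin n))

  Matrix : ℕ → Set c
  Matrix n = Fin n → Fin n → Carrier

  -- weight(π) with x_{i,j} ↦ M i j (only j ≤ i used)
  weight : ∀ {m} → Carrier → Matrix m → (Fin m → Fin m) → Carrier
  weight t M π = (t ^ N231 π) *
    ΠF (λ i → ΠF (λ j → if j ≤F i then M i j ^ expo π i j else 1#))

  P : (m : ℕ) → Carrier → Matrix m → Carrier
  P m t M = sumL (map (λ π → if isPerm π then weight t M π else 0#) (allFuns m m))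

  -- R_1(M, i) for M of size (suc k), i : Fin (suc k) (0-based; i = last is the case i = n)
  R1 : ∀ {k} → Carrier → Matrix (suc k) → Fin (suc k) → Matrix k
  R1 {k} t M i b c =
    if toℕ i ≡ᵇ k
    then M (punchIn i b) (inject₁ c)
    else (if c <F i then M (punchIn i b) (inject₁ c)
          else if c =F i then t * (M (punchIn i b) (inject₁ c) * M (punchIn i b) (suc c))
          else M (punchIn i b) (suc c))

  prefactor : ∀ {n} → Matrix n → Fin n → Carrier
  prefactor M i = ΠF (λ j → if j ≤F i then M i j ^ toℕ j else 1#)

module Submission where

-- Write π ∈ S_{n+1} as consLift v g: its first value v followed by punchIn v ∘ g with g ∈ S_n
-- (the standardisation of π(1) … π(n); indices are 0-based). The 231-patterns of π are those
-- of g together with the pairs b < c such that g c < v ≤ g b. Row v of the exponent matrix of π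
-- is x_{v,j}^j (j ≤ v), since exactly j of the later values lie below j: this is the prefactor.
-- Row punchIn v i of π is row i of g with the columns from v on shifted one to the right,
-- except that columns v and v+1 both carry the exponent e of column v of g when i ≥ v; and e is
-- also the number of extra 231-patterns whose middle value is punchIn v i. So t, x_{·,v} and
-- x_{·,v+1} appear with the same power e, which is what the merged column of R₁(X, v) records,
-- and weight π = prefactor v · weight_{R₁(X,v)} g. Summing over v and g gives the recursion;
-- functions that are not injective contribute 0 on both sides.

open import Defs
open import Algebra.Bundles using (CommutativeMonoid; CommutativeRing)
open import Data.Bool using (Bool; true; false; if_then_else_; _∧_; _∨_; not; T)
open import Data.Bool.Properties using (∧-zeroʳ; ∧-identityʳ; T-≡; T-∧; ∧-commutativeMonoid)
open import Data.Empty using (⊥-elim)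
open import Data.Fin using (Fin; zero; suc; toℕ; punchIn; punchOut; inject₁; fromℕ; fromℕ<)
open import Data.Fin.Properties
  using (toℕ-injective; toℕ<n; toℕ-inject₁; toℕ-fromℕ; toℕ-fromℕ<; suc-injective;
         punchIn-injective; punchInᵢ≢i; punchIn-punchOut; punchOut-injective; punchIn-mono-≤; punchIn-cancel-≤)
open import Data.List using (List; []; _∷_; map; concatMap; foldr; _++_)
open import Data.List.Properties using (map-∘)
open import Data.Nat as ℕ using (ℕ; zero; suc; _+_; _<_; _≤_; _<ᵇ_; _≤ᵇ_; _≡ᵇ_; s≤s)
open import Data.Nat.Properties
  using (≡ᵇ⇒≡; ≡⇒≡ᵇ; ≤ᵇ⇒≤; _<?_; _≤?_; _≟_; +-0-commutativeMonoid; +-identityʳ; ≤-refl; ≤-reflexive; ≤-trans; <-≤-trans; ≤-<-trans;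
         <⇒≤; <⇒≱; <⇒≯; <⇒≢; ≮⇒≥; ≰⇒>; ≤∧≢⇒<; n≤1+n; n<1+n; <-irrefl; ≤-pred)
open import Data.Product using (_,_; proj₁; proj₂)
open import Function using (_∘_; _⇔_; mk⇔; Equivalence; case_of_)
open import Function.Definitions using (Injective)
open import Relation.Nullary using (¬_; yes; no)
open import Relation.Nullary.Decidable using (dec-true; dec-false; does-⇔; T?)
open import Relation.Binary.PropositionalEquality as ≡ using (_≡_; _≢_; refl; cong; cong₂)

-- Sums in a commutative monoid

module Fold {c ℓ} (M : CommutativeMonoid c ℓ) where
  open CommutativeMonoid M renaming (refl to ≈-refl)
  open import Algebra.Properties.CommutativeSemigroup commutativeSemigroup using (interchange; x∙yz≈y∙xz)
  open import Relation.Binary.Reasoning.Setoid setoid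

  fold : List Carrier → Carrier
  fold = foldr _∙_ ε

  ∑ : ∀ {n} → (Fin n → Carrier) → Carrier
  ∑ {n} f = fold (map f (allFin n))

  ≡⇒≈ : ∀ {x y} → x ≡ y → x ≈ y
  ≡⇒≈ refl = ≈-refl

  fold-map-∘ : ∀ {A B : Set} (f : B → Carrier) (h : A → B) xs → fold (map f (map h xs)) ≡ fold (map (f ∘ h) xs)
  fold-map-∘ f h xs = cong fold (≡.sym (map-∘ xs))

  fold-cong : ∀ {A : Set} {f g : A → Carrier} xs → (∀ x → f x ≈ g x) → fold (map f xs) ≈ fold (map g xs)
  fold-cong []       f≈g = ≈-refl
  fold-cong (x ∷ xs) f≈g = ∙-cong (f≈g x) (fold-cong xs f≈g)

  fold-ε : ∀ {A : Set} {f : A → Carrier} xs → (∀ x → f x ≈ ε) → fold (map f xs) ≈ ε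
  fold-ε []       f≈ε = ≈-refl
  fold-ε (x ∷ xs) f≈ε = trans (∙-cong (f≈ε x) (fold-ε xs f≈ε)) (identityˡ ε)

  fold-∙ : ∀ {A : Set} (f g : A → Carrier) xs →
           fold (map (λ x → f x ∙ g x) xs) ≈ fold (map f xs) ∙ fold (map g xs)
  fold-∙ f g []       = sym (identityˡ ε)
  fold-∙ f g (x ∷ xs) = trans (∙-congˡ (fold-∙ f g xs)) (interchange (f x) (g x) _ _)

  fold-swap : ∀ {A B : Set} (f : A → B → Carrier) xs ys →
              fold (map (λ x → fold (map (f x) ys)) xs) ≈ fold (map (λ y → fold (map (λ x → f x y) xs)) ys)
  fold-swap f []       ys = sym (fold-ε ys (λ _ → ≈-refl))
  fold-swap f (x ∷ xs) ys =
    trans (∙-congˡ (fold-swap f xs ys)) (sym (fold-∙ (f x) (λ y → fold (map (λ x → f x y) xs)) ys))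

  fold-++ : ∀ {A : Set} (f : A → Carrier) xs ys → fold (map f (xs ++ ys)) ≈ fold (map f xs) ∙ fold (map f ys)
  fold-++ f []       ys = sym (identityˡ _)
  fold-++ f (x ∷ xs) ys = trans (∙-congˡ (fold-++ f xs ys)) (sym (assoc _ _ _))

  fold-concatMap : ∀ {A B : Set} (f : B → Carrier) (h : A → List B) xs →
                   fold (map f (concatMap h xs)) ≈ fold (map (λ x → fold (map f (h x))) xs)
  fold-concatMap f h []       = ≈-refl
  fold-concatMap f h (x ∷ xs) = trans (fold-++ f (h x) (concatMap h xs)) (∙-congˡ (fold-concatMap f h xs))

  ∑-suc : ∀ {n} (f : Fin (suc n) → Carrier) → ∑ f ≡ f zero ∙ ∑ (f ∘ suc)
  ∑-suc {n} f = cong (f zero ∙_) (fold-map-∘ f suc (allFin n))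

  ∑-cong : ∀ {n} {f g : Fin n → Carrier} → (∀ i → f i ≈ g i) → ∑ f ≈ ∑ g
  ∑-cong {n} = fold-cong (allFin n)

  ∑-punchIn : ∀ {n} (w : Fin (suc n)) (f : Fin (suc n) → Carrier) → ∑ f ≈ f w ∙ ∑ (f ∘ punchIn w)
  ∑-punchIn         zero    f = ≡⇒≈ (∑-suc f)
  ∑-punchIn {suc n} (suc w) f = begin
    ∑ f                                          ≡⟨ ∑-suc f ⟩
    f zero ∙ ∑ (f ∘ suc)                         ≈⟨ ∙-congˡ (∑-punchIn w (f ∘ suc)) ⟩
    f zero ∙ (f (suc w) ∙ ∑ (f ∘ suc ∘ punchIn w)) ≈⟨ x∙yz≈y∙xz _ _ _ ⟩
    f (suc w) ∙ (f zero ∙ ∑ (f ∘ suc ∘ punchIn w)) ≡⟨ cong (f (suc w) ∙_) (≡.sym (∑-suc (f ∘ punchIn (suc w)))) ⟩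
    f (suc w) ∙ ∑ (f ∘ punchIn (suc w))          ∎

  ∑-update : ∀ {n} (u : Fin n) (a : Carrier) (f g : Fin n → Carrier) →
             a ∙ f u ≈ g u → (∀ i → i ≢ u → f i ≈ g i) → a ∙ ∑ f ≈ ∑ g
  ∑-update {suc n} u a f g at-u off-u = begin
    a ∙ ∑ f                                ≈⟨ ∙-congˡ (∑-punchIn u f) ⟩
    a ∙ (f u ∙ ∑ (f ∘ punchIn u))          ≈⟨ sym (assoc _ _ _) ⟩
    (a ∙ f u) ∙ ∑ (f ∘ punchIn u)          ≈⟨ ∙-cong at-u (∑-cong (λ i → off-u (punchIn u i) (punchInᵢ≢i u i))) ⟩
    g u ∙ ∑ (g ∘ punchIn u)                ≈⟨ sym (∑-punchIn u g) ⟩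
    ∑ g                                    ∎

  ∑-reindex : ∀ {n} (g : Fin n → Fin n) → Injective _≡_ _≡_ g → (f : Fin n → Carrier) → ∑ (f ∘ g) ≈ ∑ f
  ∑-reindex {zero}  g g-inj f = ≈-refl
  ∑-reindex {suc n} g g-inj f = begin
    ∑ (f ∘ g)                                   ≡⟨ ∑-suc (f ∘ g) ⟩
    f (g zero) ∙ ∑ (f ∘ g ∘ suc)                ≈⟨ ∙-congˡ (∑-cong (λ a → ≡⇒≈ (cong f (≡.sym (punchIn-punchOut (g0≢ a)))))) ⟩
    f (g zero) ∙ ∑ (f ∘ punchIn (g zero) ∘ h)   ≈⟨ ∙-congˡ (∑-reindex h h-inj (f ∘ punchIn (g zero))) ⟩
    f (g zero) ∙ ∑ (f ∘ punchIn (g zero))       ≈⟨ sym (∑-punchIn (g zero) f) ⟩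
    ∑ f                                         ∎
    where
      g0≢ : ∀ a → g zero ≢ g (suc a)
      g0≢ a eq with () ← g-inj eq
      h : Fin n → Fin n
      h a = punchOut (g0≢ a)
      h-inj : Injective _≡_ _≡_ h
      h-inj {a} {b} eq = suc-injective (g-inj (punchOut-injective (g0≢ a) (g0≢ b) eq))

-- Boolean comparisons, punchIn and counting

<ᵇ-true : ∀ {m n} → m < n → (m <ᵇ n) ≡ true
<ᵇ-true {m} {n} = dec-true (m <? n)

<ᵇ-false : ∀ {m n} → ¬ m < n → (m <ᵇ n) ≡ false
<ᵇ-false {m} {n} = dec-false (m <? n)

≤ᵇ-true : ∀ {m n} → m ≤ n → (m ≤ᵇ n) ≡ true
≤ᵇ-true {m} {n} = dec-true (m ≤? n)

≤ᵇ-false : ∀ {m n} → ¬ m ≤ n → (m ≤ᵇ n) ≡ false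
≤ᵇ-false {m} {n} = dec-false (m ≤? n)

≡ᵇ-refl : ∀ m → (m ≡ᵇ m) ≡ true
≡ᵇ-refl m = dec-true (m ≟ m) refl

≡ᵇ-false : ∀ {m n} → m ≢ n → (m ≡ᵇ n) ≡ false
≡ᵇ-false {m} {n} = dec-false (m ≟ n)

<ᵇ-cong : ∀ {m n m′ n′} → (m < n ⇔ m′ < n′) → (m <ᵇ n) ≡ (m′ <ᵇ n′)
<ᵇ-cong {m} {n} {m′} {n′} e = does-⇔ e (m <? n) (m′ <? n′)

≤ᵇ-cong : ∀ {m n m′ n′} → (m ≤ n ⇔ m′ ≤ n′) → (m ≤ᵇ n) ≡ (m′ ≤ᵇ n′)
≤ᵇ-cong {m} {n} {m′} {n′} e = does-⇔ e (m ≤? n) (m′ ≤? n′)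

≡ᵇ-cong : ∀ {m n m′ n′} → (m ≡ n ⇔ m′ ≡ n′) → (m ≡ᵇ n) ≡ (m′ ≡ᵇ n′)
≡ᵇ-cong {m} {n} {m′} {n′} e = does-⇔ e (m ≟ n) (m′ ≟ n′)

toℕ-punchIn-below : ∀ {n} (i : Fin (suc n)) (j : Fin n) → toℕ j < toℕ i → toℕ (punchIn i j) ≡ toℕ j
toℕ-punchIn-below (suc i) zero    _         = refl
toℕ-punchIn-below (suc i) (suc j) (s≤s j<i) = cong suc (toℕ-punchIn-below i j j<i)

toℕ-punchIn-above : ∀ {n} (i : Fin (suc n)) (j : Fin n) → toℕ i ≤ toℕ j → toℕ (punchIn i j) ≡ suc (toℕ j)
toℕ-punchIn-above zero    j       _         = refl
toℕ-punchIn-above (suc i) (suc j) (s≤s i≤j) = cong suc (toℕ-punchIn-above i j i≤j)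

data PunchInView {n} (i : Fin (suc n)) (j : Fin n) : Set where
  below : toℕ j < toℕ i → toℕ (punchIn i j) ≡ toℕ j → PunchInView i j
  above : toℕ i ≤ toℕ j → toℕ (punchIn i j) ≡ suc (toℕ j) → PunchInView i j

punchInView : ∀ {n} (i : Fin (suc n)) (j : Fin n) → PunchInView i j
punchInView i j with toℕ j <? toℕ i
... | yes j<i = below j<i (toℕ-punchIn-below i j j<i)
... | no  j≮i = above (≮⇒≥ j≮i) (toℕ-punchIn-above i j (≮⇒≥ j≮i))

punchIn-<ᵇ-below : ∀ {n} (v : Fin (suc n)) (x : Fin n) C → C ≤ toℕ v → (toℕ (punchIn v x) <ᵇ C) ≡ (toℕ x <ᵇ C)
punchIn-<ᵇ-below v x C C≤v with punchInView v x
... | below _   eq rewrite eq = refl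
... | above v≤x eq rewrite eq =
  ≡.trans (<ᵇ-false (λ q → <⇒≱ q (≤-trans C≤v (≤-trans v≤x (n≤1+n _)))))
          (≡.sym (<ᵇ-false (λ q → <⇒≱ q (≤-trans C≤v v≤x))))

punchIn-<ᵇ-above : ∀ {n} (v : Fin (suc n)) (x : Fin n) C → toℕ v ≤ C → (toℕ (punchIn v x) <ᵇ suc C) ≡ (toℕ x <ᵇ C)
punchIn-<ᵇ-above v x C v≤C with punchInView v x
... | below x<v eq rewrite eq =
  ≡.trans (<ᵇ-true (≤-trans x<v (≤-trans v≤C (n≤1+n _)))) (≡.sym (<ᵇ-true (<-≤-trans x<v v≤C)))
... | above _   eq rewrite eq = refl

punchIn-=F : ∀ {n} (v : Fin (suc n)) (x y : Fin n) → (punchIn v x =F punchIn v y) ≡ (x =F y)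
punchIn-=F v x y = ≡ᵇ-cong (mk⇔ (cong toℕ ∘ punchIn-injective v x y ∘ toℕ-injective)
                                (cong (toℕ ∘ punchIn v) ∘ toℕ-injective))

punchIn-<F : ∀ {n} (v : Fin (suc n)) (x y : Fin n) → (punchIn v x <F punchIn v y) ≡ (x <F y)
punchIn-<F v x y = <ᵇ-cong (mk⇔ (λ q → ≰⇒> (<⇒≱ q ∘ punchIn-mono-≤ v y x))
                                (λ q → ≰⇒> (<⇒≱ q ∘ punchIn-cancel-≤ v y x)))

punchIn-=F-pivot : ∀ {n} (v : Fin (suc n)) (x : Fin n) → (punchIn v x =F v) ≡ false
punchIn-=F-pivot v x = ≡ᵇ-false (punchInᵢ≢i v x ∘ toℕ-injective)

pivot-=F-punchIn : ∀ {n} (v : Fin (suc n)) (x : Fin n) → (v =F punchIn v x) ≡ false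
pivot-=F-punchIn v x = ≡ᵇ-false (punchInᵢ≢i v x ∘ toℕ-injective ∘ ≡.sym)

pivot-<F-punchIn : ∀ {n} (v : Fin (suc n)) (x : Fin n) → (v <F punchIn v x) ≡ (v ≤F x)
pivot-<F-punchIn v x with punchInView v x
... | below x<v eq rewrite eq = ≡.trans (<ᵇ-false (λ q → <⇒≱ q (≤-trans (n≤1+n _) x<v))) (≡.sym (≤ᵇ-false (<⇒≱ x<v)))
... | above v≤x eq rewrite eq = ≡.trans (<ᵇ-true (s≤s v≤x)) (≡.sym (≤ᵇ-true v≤x))

module ℕΣ = Fold +-0-commutativeMonoid
module 𝔹∧ = Fold ∧-commutativeMonoid
open ℕΣ using (∑-suc) renaming (∑ to ∑ℕ)

indicator : Bool → ℕ
indicator b = if b then 1 else 0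

count-cong : ∀ {n} {p q : Fin n → Bool} → (∀ a → p a ≡ q a) → count p ≡ count q
count-cong p≡q = ℕΣ.∑-cong (cong indicator ∘ p≡q)

count-none : ∀ {n} {p : Fin n → Bool} → (∀ a → p a ≡ false) → count p ≡ 0
count-none {n} none = ℕΣ.fold-ε (allFin n) (cong indicator ∘ none)

count-suc : ∀ {n} (p : Fin (suc n) → Bool) → count p ≡ indicator (p zero) + count (p ∘ suc)
count-suc p = ∑-suc (indicator ∘ p)

count-reindex : ∀ {n} (g : Fin n → Fin n) → Injective _≡_ _≡_ g → (p : Fin n → Bool) →
                count (p ∘ g) ≡ count p
count-reindex g g-inj p = ℕΣ.∑-reindex g g-inj (indicator ∘ p)

count-below : ∀ n J → J ≤ n → count {n} (λ x → toℕ x <ᵇ J) ≡ J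
count-below zero    zero    _         = refl
count-below (suc n) zero    _         = ≡.trans (count-suc {n} (λ x → toℕ x <ᵇ 0)) (count-none {n} (λ _ → refl))
count-below (suc n) (suc J) (s≤s J≤n) = ≡.trans (count-suc {n} (λ x → toℕ x <ᵇ suc J)) (cong suc (count-below n J J≤n))

count2-cong : ∀ {n} {p q : Fin n → Fin n → Bool} → (∀ a b → p a b ≡ q a b) → count2 p ≡ count2 q
count2-cong p≡q = ℕΣ.∑-cong (λ a → count-cong (p≡q a))

count3-cong : ∀ {n} {p q : Fin n → Fin n → Fin n → Bool} → (∀ a b c → p a b c ≡ q a b c) → count3 p ≡ count3 q
count3-cong p≡q = ℕΣ.∑-cong (λ a → count2-cong (p≡q a))

count2-<-suc : ∀ {n} (Q : Fin (suc n) → Fin (suc n) → Bool) →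
               count2 (λ a b → (a <F b) ∧ Q a b) ≡
               count (λ b → Q zero (suc b)) + count2 (λ a b → (a <F b) ∧ Q (suc a) (suc b))
count2-<-suc {n} Q = ≡.trans (∑-suc (λ a → count (λ b → (a <F b) ∧ Q a b)))
  (cong₂ _+_ (count-suc (λ b → (zero {n} <F b) ∧ Q zero b))
             (ℕΣ.∑-cong (λ a → count-suc (λ b → (suc a <F b) ∧ Q (suc a) b))))

count3-<-suc : ∀ {n} (Q : Fin (suc n) → Fin (suc n) → Fin (suc n) → Bool) →
               count3 (λ a b c → (a <F b) ∧ (b <F c) ∧ Q a b c) ≡
               count2 (λ b c → (b <F c) ∧ Q zero (suc b) (suc c)) +
               count3 (λ a b c → (a <F b) ∧ (b <F c) ∧ Q (suc a) (suc b) (suc c))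
count3-<-suc {n} Q = ≡.trans (∑-suc (λ a → count2 (λ b c → (a <F b) ∧ (b <F c) ∧ Q a b c)))
                          (cong₂ _+_ (drop-first zero) (ℕΣ.∑-cong (drop-first ∘ suc)))
  where
    drop-first : ∀ a → count2 (λ b c → (a <F b) ∧ (b <F c) ∧ Q a b c) ≡
                       count2 (λ b c → (a <F suc b) ∧ (b <F c) ∧ Q a (suc b) (suc c))
    drop-first a = ≡.trans (∑-suc (λ b → count (λ c → (a <F b) ∧ (b <F c) ∧ Q a b c)))
      (cong₂ _+_ (count-none {suc n} (λ _ → refl))
                 (ℕΣ.∑-cong (λ b → ≡.trans (count-suc (λ c → (a <F suc b) ∧ (suc b <F c) ∧ Q a (suc b) c))
                                           (cong (λ x → indicator x + count (λ c → (a <F suc b) ∧ (b <F c) ∧ Q a (suc b) (suc c)))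
                                                 (∧-zeroʳ (a <F suc b))))))

∑ℕ-select : ∀ {n} (x : Fin n) (y : Fin n → ℕ) → ∑ℕ (λ i → if x =F i then y i else 0) ≡ y x
∑ℕ-select {suc n} x y = begin
  ∑ℕ (λ i → if x =F i then y i else 0)                     ≡⟨ ℕΣ.∑-punchIn x _ ⟩
  (if x =F x then y x else 0) +
    ∑ℕ (λ j → if x =F punchIn x j then y (punchIn x j) else 0) ≡⟨ cong₂ _+_ hit miss ⟩
  y x + 0                                                   ≡⟨ +-identityʳ (y x) ⟩
  y x                                                       ∎
  where
    open ≡.≡-Reasoning
    hit : (if x =F x then y x else 0) ≡ y x
    hit = cong (λ b → if b then y x else 0) (≡ᵇ-refl (toℕ x))
    miss : ∑ℕ (λ j → if x =F punchIn x j then y (punchIn x j) else 0) ≡ 0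
    miss = ℕΣ.fold-ε (allFin n) (λ j → cong (λ b → if b then y (punchIn x j) else 0) (pivot-=F-punchIn x j))

if-∑ : ∀ {n} b (f : Fin n → ℕ) → (if b then ∑ℕ f else 0) ≡ ∑ℕ (λ a → if b then f a else 0)
if-∑     true  f = refl
if-∑ {n} false f = ≡.sym (ℕΣ.fold-ε (allFin n) (λ _ → refl))

-- Permutations, decomposed by their first value

T-ext : ∀ {x y} → (T x ⇔ T y) → x ≡ y
T-ext {x} {y} e = does-⇔ e (T? x) (T? y)

T-=F : ∀ {n} {i j : Fin n} → T (i =F j) ⇔ i ≡ j
T-=F {i = i} {j} = mk⇔ (toℕ-injective ∘ ≡ᵇ⇒≡ (toℕ i) (toℕ j)) (≡⇒≡ᵇ (toℕ i) (toℕ j) ∘ cong toℕ)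

T-implication : ∀ {x y} → T (not x ∨ y) ⇔ (T x → T y)
T-implication {false} {y}     = mk⇔ (λ _ ()) _
T-implication {true}  {false} = mk⇔ (λ ()) (λ f → f _)
T-implication {true}  {true}  = mk⇔ _ _

T-allB : ∀ {n} (p : Fin n → Bool) → T (allB p) ⇔ (∀ a → T (p a))
T-allB {zero}  p = mk⇔ (λ _ ()) _
T-allB {suc n} p rewrite 𝔹∧.∑-suc p = mk⇔
  (λ t → λ { zero → proj₁ (to T-∧ t) ; (suc a) → to (T-allB (p ∘ suc)) (proj₂ (to T-∧ t)) a })
  (λ h → from T-∧ (h zero , from (T-allB (p ∘ suc)) (h ∘ suc)))
  where open Equivalence

isPerm⇔injective : ∀ {m} (π : Fin m → Fin m) → T (isPerm π) ⇔ Injective _≡_ _≡_ π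
isPerm⇔injective {m} π = mk⇔
  (λ t {a} {b} → to T-=F ∘ to T-implication (to (T-allB (no-collision a)) (to (T-allB _) t a) b) ∘ from T-=F)
  (λ inj → from (T-allB _) λ a → from (T-allB (no-collision a)) λ b →
             from T-implication (from (T-=F {i = a}) ∘ inj ∘ to (T-=F {i = π a})))
  where
    open Equivalence
    no-collision : Fin m → Fin m → Bool
    no-collision a b = not (π a =F π b) ∨ (a =F b)

-- Pointwise equal to punchIn v ∘ g, but built along consF like allFuns: liftAvoiding v (consF w g)
-- reduces to consF (punchIn v w) (liftAvoiding v g), and for m = 0 it is the absurd function listed
-- in allFuns, so sums over allFuns can be reindexed without function extensionality.
liftAvoiding : ∀ {m k} → Fin (suc k) → (Fin m → Fin k) → Fin m → Fin (suc k)
liftAvoiding {zero}  {k} v g with allFuns zero (suc k)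
... | f ∷ _ = f
liftAvoiding {suc m} v g = consF (punchIn v (g zero)) (liftAvoiding v (g ∘ suc))

liftAvoiding-apply : ∀ {m k} (v : Fin (suc k)) (g : Fin m → Fin k) a → liftAvoiding v g a ≡ punchIn v (g a)
liftAvoiding-apply {suc m} v g zero    = refl
liftAvoiding-apply {suc m} v g (suc a) = liftAvoiding-apply v (g ∘ suc) a

consLift : ∀ {n} → Fin (suc n) → (Fin n → Fin n) → Fin (suc n) → Fin (suc n)
consLift v g = consF v (liftAvoiding v g)

consLift-injective⁻¹ : ∀ {n} (v : Fin (suc n)) (g : Fin n → Fin n) →
                       Injective _≡_ _≡_ (consLift v g) → Injective _≡_ _≡_ g
consLift-injective⁻¹ v g inj {a} {b} e = suc-injective (inj (begin
  liftAvoiding v g a ≡⟨ liftAvoiding-apply v g a ⟩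
  punchIn v (g a)    ≡⟨ cong (punchIn v) e ⟩
  punchIn v (g b)    ≡⟨ liftAvoiding-apply v g b ⟨
  liftAvoiding v g b ∎))
  where open ≡.≡-Reasoning

consLift-injective : ∀ {n} (v : Fin (suc n)) (g : Fin n → Fin n) →
                     Injective _≡_ _≡_ g → Injective _≡_ _≡_ (consLift v g)
consLift-injective v g inj {zero}  {zero}  e = refl
consLift-injective v g inj {zero}  {suc b} e = ⊥-elim (punchInᵢ≢i v (g b) (≡.sym (≡.trans e (liftAvoiding-apply v g b))))
consLift-injective v g inj {suc a} {zero}  e = ⊥-elim (punchInᵢ≢i v (g a) (≡.trans (≡.sym (liftAvoiding-apply v g a)) e))
consLift-injective v g inj {suc a} {suc b} e = cong suc (inj (punchIn-injective v (g a) (g b)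
  (≡.trans (≡.sym (liftAvoiding-apply v g a)) (≡.trans e (liftAvoiding-apply v g b)))))

isPerm-consLift : ∀ {n} (v : Fin (suc n)) (g : Fin n → Fin n) → isPerm (consLift v g) ≡ isPerm g
isPerm-consLift v g = T-ext (mk⇔
  (from (isPerm⇔injective g) ∘ consLift-injective⁻¹ v g ∘ to (isPerm⇔injective (consLift v g)))
  (from (isPerm⇔injective (consLift v g)) ∘ consLift-injective v g ∘ to (isPerm⇔injective g)))
  where open Equivalence

isPerm-repeat : ∀ {n} (v : Fin (suc n)) (f : Fin n → Fin (suc n)) a → f a ≡ v → isPerm (consF v f) ≡ false
isPerm-repeat v f a fa≡v = dec-false (T? _) λ t →
  case to (isPerm⇔injective (consF v f)) t {zero} {suc a} (≡.sym fa≡v) of λ ()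
  where open Equivalence

module SumOverFunctions {c ℓ} (M : CommutativeMonoid c ℓ) where
  open CommutativeMonoid M renaming (refl to ≈-refl)
  open Fold M
  open import Relation.Binary.Reasoning.Setoid setoid

  ∑-allFuns-suc : ∀ m k (F : (Fin (suc m) → Fin k) → Carrier) →
                  fold (map F (allFuns (suc m) k)) ≈ ∑ (λ w → fold (map (λ f → F (consF w f)) (allFuns m k)))
  ∑-allFuns-suc m k F = begin
    fold (map F (allFuns (suc m) k))
      ≈⟨ fold-concatMap F (λ f → map (λ w → consF w f) (allFin k)) (allFuns m k) ⟩
    fold (map (λ f → fold (map F (map (λ w → consF w f) (allFin k)))) (allFuns m k))
      ≈⟨ fold-cong (allFuns m k) (λ f → ≡⇒≈ (fold-map-∘ F (λ w → consF w f) (allFin k))) ⟩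
    fold (map (λ f → ∑ (λ w → F (consF w f))) (allFuns m k))
      ≈⟨ fold-swap (λ f w → F (consF w f)) (allFuns m k) (allFin k) ⟩
    ∑ (λ w → fold (map (λ f → F (consF w f)) (allFuns m k))) ∎

  ∑-allFuns-avoiding : ∀ m {k} (v : Fin (suc k)) (F : (Fin m → Fin (suc k)) → Carrier) →
                       (∀ f a → f a ≡ v → F f ≈ ε) →
                       fold (map F (allFuns m (suc k))) ≈ fold (map (F ∘ liftAvoiding v) (allFuns m k))
  ∑-allFuns-avoiding zero    v F _      = ≈-refl
  ∑-allFuns-avoiding (suc m) {k} v F F-hit = begin
    fold (map F (allFuns (suc m) (suc k)))
      ≈⟨ ∑-allFuns-suc m (suc k) F ⟩
    ∑ (λ w → fold (map (F ∘ consF w) (allFuns m (suc k))))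
      ≈⟨ ∑-punchIn v (λ w → fold (map (F ∘ consF w) (allFuns m (suc k)))) ⟩
    fold (map (F ∘ consF v) (allFuns m (suc k))) ∙ ∑ (λ w → fold (map (F ∘ consF (punchIn v w)) (allFuns m (suc k))))
      ≈⟨ ∙-cong (fold-ε (allFuns m (suc k)) (λ f → F-hit (consF v f) zero refl)) (∑-cong avoid-v) ⟩
    ε ∙ ∑ (λ w → fold (map (F ∘ liftAvoiding v ∘ consF w) (allFuns m k)))
      ≈⟨ identityˡ _ ⟩
    ∑ (λ w → fold (map (F ∘ liftAvoiding v ∘ consF w) (allFuns m k)))
      ≈⟨ ∑-allFuns-suc m k (F ∘ liftAvoiding v) ⟨
    fold (map (F ∘ liftAvoiding v) (allFuns (suc m) k)) ∎
    where
      avoid-v : ∀ w → fold (map (F ∘ consF (punchIn v w)) (allFuns m (suc k))) ≈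
                      fold (map (F ∘ liftAvoiding v ∘ consF w) (allFuns m k))
      avoid-v w = ∑-allFuns-avoiding m v (F ∘ consF (punchIn v w)) (λ f a → F-hit (consF (punchIn v w) f) (suc a))

-- The statistics of consLift v g, and its weight

-- expo π i j is definitionally expoAt π i (toℕ j).
expoAt : ∀ {m} → (Fin m → Fin m) → Fin m → ℕ → ℕ
expoAt π i J = count2 (λ a b → (a <F b) ∧ (π a =F i) ∧ (toℕ (π b) <ᵇ J))

N231-head : ∀ {n} → Fin (suc n) → (Fin n → Fin n) → ℕ
N231-head v g = count2 (λ b c → (b <F c) ∧ (g c <F v) ∧ (v ≤F g b))

module ConsLiftStatistics {n} (v : Fin (suc n)) (g : Fin n → Fin n) where

  π : Fin (suc n) → Fin (suc n)
  π = consLift v g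

  π-suc : ∀ a → π (suc a) ≡ punchIn v (g a)
  π-suc = liftAvoiding-apply v g

  expoAt-consLift : ∀ p J → expoAt π p J ≡
    count (λ b → (v =F p) ∧ (toℕ (punchIn v (g b)) <ᵇ J)) +
    count2 (λ a b → (a <F b) ∧ (punchIn v (g a) =F p) ∧ (toℕ (punchIn v (g b)) <ᵇ J))
  expoAt-consLift p J = ≡.trans (count2-<-suc (λ a b → (π a =F p) ∧ (toℕ (π b) <ᵇ J)))
    (cong₂ _+_ (count-cong (λ b → cong (λ x → (v =F p) ∧ (toℕ x <ᵇ J)) (π-suc b)))
               (count2-cong (λ a b → cong₂ (λ x y → (a <F b) ∧ (x =F p) ∧ (toℕ y <ᵇ J)) (π-suc a) (π-suc b))))

  expoAt-punchIn : ∀ i J → expoAt π (punchIn v i) J ≡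
    count2 (λ a b → (a <F b) ∧ (g a =F i) ∧ (toℕ (punchIn v (g b)) <ᵇ J))
  expoAt-punchIn i J = ≡.trans (expoAt-consLift (punchIn v i) J)
    (cong₂ _+_ (count-none (λ b → cong (_∧ (toℕ (punchIn v (g b)) <ᵇ J)) (pivot-=F-punchIn v i)))
               (count2-cong (λ a b → cong (λ x → (a <F b) ∧ x ∧ (toℕ (punchIn v (g b)) <ᵇ J)) (punchIn-=F v (g a) i))))

  expoAt-punchIn-below : ∀ i J → J ≤ toℕ v → expoAt π (punchIn v i) J ≡ expoAt g i J
  expoAt-punchIn-below i J J≤v = ≡.trans (expoAt-punchIn i J)
    (count2-cong (λ a b → cong (λ x → (a <F b) ∧ (g a =F i) ∧ x) (punchIn-<ᵇ-below v (g b) J J≤v)))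

  expoAt-punchIn-above : ∀ i J → toℕ v ≤ J → expoAt π (punchIn v i) (suc J) ≡ expoAt g i J
  expoAt-punchIn-above i J v≤J = ≡.trans (expoAt-punchIn i (suc J))
    (count2-cong (λ a b → cong (λ x → (a <F b) ∧ (g a =F i) ∧ x) (punchIn-<ᵇ-above v (g b) J v≤J)))

  expoAt-pivot : Injective _≡_ _≡_ g → ∀ J → J ≤ toℕ v → expoAt π v J ≡ J
  expoAt-pivot g-inj J J≤v =
    ≡.trans (expoAt-consLift v J) (≡.trans (cong₂ _+_ first rest) (+-identityʳ J))
    where
      open ≡.≡-Reasoning
      first : count (λ b → (v =F v) ∧ (toℕ (punchIn v (g b)) <ᵇ J)) ≡ J
      first = begin
        count (λ b → (v =F v) ∧ (toℕ (punchIn v (g b)) <ᵇ J)) ≡⟨ count-cong (λ b → cong₂ _∧_ (≡ᵇ-refl (toℕ v)) (punchIn-<ᵇ-below v (g b) J J≤v)) ⟩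
        count (λ b → toℕ (g b) <ᵇ J)                         ≡⟨ count-reindex g g-inj (λ x → toℕ x <ᵇ J) ⟩
        count {n} (λ x → toℕ x <ᵇ J)                         ≡⟨ count-below n J (≤-trans J≤v (≤-pred (toℕ<n v))) ⟩
        J                                                    ∎
      rest : count2 (λ a b → (a <F b) ∧ (punchIn v (g a) =F v) ∧ (toℕ (punchIn v (g b)) <ᵇ J)) ≡ 0
      rest = ℕΣ.fold-ε (allFin n) λ a → count-none λ b →
        ≡.trans (cong (λ x → (a <F b) ∧ x ∧ (toℕ (punchIn v (g b)) <ᵇ J)) (punchIn-=F-pivot v (g a))) (∧-zeroʳ (a <F b))

  N231-consLift : N231 π ≡ N231-head v g + N231 g
  N231-consLift = ≡.trans (count3-<-suc (λ a b c → (π c <F π a) ∧ (π a <F π b)))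
    (cong₂ _+_ (count2-cong λ b c → cong ((b <F c) ∧_) (head-triple b c))
               (count3-cong λ a b c → cong (λ x → (a <F b) ∧ (b <F c) ∧ x) (tail-triple a b c)))
    where
      head-triple : ∀ b c → ((π (suc c) <F v) ∧ (v <F π (suc b))) ≡ ((g c <F v) ∧ (v ≤F g b))
      head-triple b c rewrite π-suc b | π-suc c =
        cong₂ _∧_ (punchIn-<ᵇ-below v (g c) (toℕ v) ≤-refl) (pivot-<F-punchIn v (g b))
      tail-triple : ∀ a b c → ((π (suc c) <F π (suc a)) ∧ (π (suc a) <F π (suc b))) ≡ ((g c <F g a) ∧ (g a <F g b))
      tail-triple a b c rewrite π-suc a | π-suc b | π-suc c =
        cong₂ _∧_ (punchIn-<F v (g c) (g a)) (punchIn-<F v (g a) (g b))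

  headShare : Fin n → ℕ
  headShare i = if v ≤F i then expoAt g i (toℕ v) else 0

  N231-head-by-rows : N231-head v g ≡ ∑ℕ headShare
  N231-head-by-rows = ≡.sym (begin
    ∑ℕ headShare
      ≡⟨ ℕΣ.∑-cong {n} (λ i → if-∑ {n} (v ≤F i) (λ a → count (λ b → (a <F b) ∧ (g a =F i) ∧ (g b <F v)))) ⟩
    ∑ℕ {n} (λ i → ∑ℕ {n} (λ a → row-pairs i a))
      ≡⟨ ℕΣ.fold-swap row-pairs (allFin n) (allFin n) ⟩
    ∑ℕ {n} (λ a → ∑ℕ {n} (λ i → row-pairs i a))
      ≡⟨ ℕΣ.∑-cong {n} (λ a → ≡.trans (ℕΣ.∑-cong {n} (only-row a)) (∑ℕ-select (g a) (later-below a))) ⟩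
    ∑ℕ {n} (λ a → later-below a (g a))
      ≡⟨ ℕΣ.∑-cong later-below-row ⟩
    N231-head v g ∎)
    where
      open ≡.≡-Reasoning
      row-pairs : Fin n → Fin n → ℕ
      row-pairs i a = if v ≤F i then count (λ b → (a <F b) ∧ (g a =F i) ∧ (g b <F v)) else 0
      later-below : Fin n → Fin n → ℕ
      later-below a i = if v ≤F i then count (λ b → (a <F b) ∧ (g b <F v)) else 0
      only-row : ∀ a i → row-pairs i a ≡ (if g a =F i then later-below a i else 0)
      only-row a i with g a =F i | v ≤F i
      ... | true  | _     = refl
      ... | false | true  = count-none {n} (λ b → ∧-zeroʳ (a <F b))
      ... | false | false = refl
      later-below-row : ∀ a → later-below a (g a) ≡ count (λ c → (a <F c) ∧ (g c <F v) ∧ (v ≤F g a))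
      later-below-row a with v ≤F g a
      ... | true  = count-cong (λ c → cong ((a <F c) ∧_) (≡.sym (∧-identityʳ (g c <F v))))
      ... | false = ≡.sym (count-none {n} (λ c → ≡.trans (cong ((a <F c) ∧_) (∧-zeroʳ (g c <F v))) (∧-zeroʳ (a <F c))))

module Weights {c ℓ} (R : CommutativeRing c ℓ) where
  open CommutativeRing R hiding (zero) renaming (refl to ≈-refl; sym to ≈-sym; trans to ≈-trans)
  open WithRing R
  open import Relation.Binary.Reasoning.Setoid setoid
  open import Algebra.Properties.CommutativeSemigroup *-commutativeSemigroup using (interchange; xy∙z≈xz∙y; x∙yz≈zx∙y; xy∙z≈z∙yx; x∙yz≈y∙xz)
  module RΣ = Fold +-commutativeMonoid
  module RΠ = Fold *-commutativeMonoid
  open RΣ using (≡⇒≈)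

  ^-+ : ∀ x m n → x ^ (m ℕ.+ n) ≈ x ^ m * x ^ n
  ^-+ x zero    n = ≈-sym (*-identityˡ _)
  ^-+ x (suc m) n = ≈-trans (*-congˡ (^-+ x m n)) (≈-sym (*-assoc _ _ _))

  ^-distrib-* : ∀ x y n → (x * y) ^ n ≈ x ^ n * y ^ n
  ^-distrib-* x y zero    = ≈-sym (*-identityˡ _)
  ^-distrib-* x y (suc n) = ≈-trans (*-congˡ (^-distrib-* x y n)) (interchange x y _ _)

  ^-∑ : ∀ {n} x (k : Fin n → ℕ) → x ^ ∑ℕ k ≈ ΠF (λ i → x ^ k i)
  ^-∑ {zero}  x k = ≈-refl
  ^-∑ {suc n} x k = begin
    x ^ ∑ℕ k                               ≡⟨ cong (x ^_) (∑-suc k) ⟩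
    x ^ (k zero ℕ.+ ∑ℕ (k ∘ suc))          ≈⟨ ^-+ x (k zero) (∑ℕ (k ∘ suc)) ⟩
    x ^ k zero * x ^ ∑ℕ (k ∘ suc)          ≈⟨ *-congˡ (^-∑ x (k ∘ suc)) ⟩
    x ^ k zero * ΠF (λ i → x ^ k (suc i))  ≡⟨ RΠ.∑-suc (λ i → x ^ k i) ⟨
    ΠF (λ i → x ^ k i)                     ∎

  *-distribˡ-fold : ∀ {A : Set} a (f : A → Carrier) xs → a * RΣ.fold (map f xs) ≈ RΣ.fold (map (λ x → a * f x) xs)
  *-distribˡ-fold a f []       = zeroʳ a
  *-distribˡ-fold a f (x ∷ xs) = ≈-trans (distribˡ a (f x) _) (+-congˡ (*-distribˡ-fold a f xs))

  if-cong-then : ∀ {b b′ : Bool} {x x′ y : Carrier} → b ≡ b′ → (T b′ → x ≡ x′) →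
                 (if b then x else y) ≡ (if b′ then x′ else y)
  if-cong-then {b′ = true}  refl x≡x′ = x≡x′ _
  if-cong-then {b′ = false} refl _    = refl

  cell : ∀ {m} → Matrix m → (Fin m → Fin m) → Fin m → Fin m → Carrier
  cell M π i j = if j ≤F i then M i j ^ expo π i j else 1#

  row : ∀ {m} → Matrix m → (Fin m → Fin m) → Fin m → Carrier
  row M π i = ΠF (cell M π i)

  summand : ∀ {m} → Carrier → Matrix m → (Fin m → Fin m) → Carrier
  summand t M σ = if isPerm σ then weight t M σ else 0#

  module ConsLiftWeight (t : Carrier) {n} (X : Matrix (suc n)) (v : Fin (suc n)) (g : Fin n → Fin n) where
    open ConsLiftStatistics v g

    X′ : Matrix n
    X′ = R1 t X v

    R1-left : ∀ i c → toℕ c < toℕ v → X′ i c ≡ X (punchIn v i) (inject₁ c)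
    R1-left i c c<v with toℕ v ≡ᵇ n
    ... | true  = refl
    ... | false rewrite <ᵇ-true c<v = refl

    R1-merged : ∀ i c → toℕ v < n → toℕ c ≡ toℕ v →
                X′ i c ≡ t * (X (punchIn v i) (inject₁ c) * X (punchIn v i) (suc c))
    R1-merged i c v<n c≡v
      rewrite ≡ᵇ-false (<⇒≢ v<n) | c≡v | <ᵇ-false (<-irrefl (refl {x = toℕ v})) | ≡ᵇ-refl (toℕ v) = refl

    R1-right : ∀ i c → toℕ v < n → toℕ v < toℕ c → X′ i c ≡ X (punchIn v i) (suc c)
    R1-right i c v<n v<c
      rewrite ≡ᵇ-false (<⇒≢ v<n) | <ᵇ-false (<⇒≯ v<c) | ≡ᵇ-false (<⇒≢ v<c ∘ ≡.sym) = refl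

    entry-left : ∀ i c (j : Fin (suc n)) → toℕ j ≡ toℕ c → toℕ c < toℕ v →
                 X (punchIn v i) j ^ expo π (punchIn v i) j ≡ X′ i c ^ expo g i c
    entry-left i c j j≡c c<v = cong₂ _^_
      (≡.trans (cong (X (punchIn v i)) (toℕ-injective (≡.trans j≡c (≡.sym (toℕ-inject₁ c))))) (≡.sym (R1-left i c c<v)))
      (≡.trans (cong (expoAt π (punchIn v i)) j≡c) (expoAt-punchIn-below i (toℕ c) (<⇒≤ c<v)))

    entry-right : ∀ i c (j : Fin (suc n)) → toℕ j ≡ suc (toℕ c) → toℕ v < n → toℕ v < toℕ c →
                  X (punchIn v i) j ^ expo π (punchIn v i) j ≡ X′ i c ^ expo g i c
    entry-right i c j j≡1+c v<n v<c = cong₂ _^_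
      (≡.trans (cong (X (punchIn v i)) (toℕ-injective j≡1+c)) (≡.sym (R1-right i c v<n v<c)))
      (≡.trans (cong (expoAt π (punchIn v i)) j≡1+c) (expoAt-punchIn-above i (toℕ c) (<⇒≤ v<c)))

    row-left : ∀ i → toℕ i < toℕ v → toℕ (punchIn v i) ≡ toℕ i → row X π (punchIn v i) * t ^ headShare i ≈ row X′ g i
    row-left i i<v p≡i = begin
      row X π p * t ^ headShare i                                     ≡⟨ cong (λ k → row X π p * t ^ k) no-share ⟩
      row X π p * 1#                                              ≈⟨ *-identityʳ _ ⟩
      row X π p                                                   ≈⟨ RΠ.∑-punchIn (fromℕ n) (cell X π p) ⟩
      cell X π p (fromℕ n) * ΠF (cell X π p ∘ punchIn (fromℕ n))  ≈⟨ *-cong (≡⇒≈ last-column) (RΠ.∑-cong (≡⇒≈ ∘ column)) ⟩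
      1# * row X′ g i                                             ≈⟨ *-identityˡ _ ⟩
      row X′ g i                                                  ∎
      where
        p : Fin (suc n)
        p = punchIn v i
        no-share : headShare i ≡ 0
        no-share = cong (if_then expoAt g i (toℕ v) else 0) (≤ᵇ-false (<⇒≱ i<v))
        last-column : cell X π p (fromℕ n) ≡ 1#
        last-column = cong (if_then X p (fromℕ n) ^ expo π p (fromℕ n) else 1#)
          (≤ᵇ-false (λ n≤p → <⇒≱ (toℕ<n i) (≡.subst₂ _≤_ (toℕ-fromℕ n) p≡i n≤p)))
        column : ∀ c → cell X π p (punchIn (fromℕ n) c) ≡ cell X′ g i c
        column c = if-cong-then (cong₂ _≤ᵇ_ j≡c p≡i) (λ c≤i → entry-left i c _ j≡c (≤-<-trans (≤ᵇ⇒≤ _ _ c≤i) i<v))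
          where
            j≡c : toℕ (punchIn (fromℕ n) c) ≡ toℕ c
            j≡c = toℕ-punchIn-below (fromℕ n) c (≡.subst (toℕ c <_) (≡.sym (toℕ-fromℕ n)) (toℕ<n c))

    module AboveRow (i : Fin n) (v≤i : toℕ v ≤ toℕ i) (p≡1+i : toℕ (punchIn v i) ≡ suc (toℕ i)) where
      p : Fin (suc n)
      p = punchIn v i

      v<n : toℕ v < n
      v<n = ≤-<-trans v≤i (toℕ<n i)

      u : Fin n
      u = fromℕ< v<n

      u≡v : toℕ u ≡ toℕ v
      u≡v = toℕ-fromℕ< v<n

      e : ℕ
      e = expoAt g i (toℕ v)

      F : Fin n → Carrier
      F c = cell X π p (punchIn (suc u) c)

      share≡e : headShare i ≡ e
      share≡e = cong (if_then e else 0) (≤ᵇ-true v≤i)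

      A B : Carrier
      A = X p (inject₁ u)
      B = X p (suc u)

      u≤i : toℕ u ≤ toℕ i
      u≤i = ≡.subst (_≤ toℕ i) (≡.sym u≡v) v≤i

      right-half : cell X π p (suc u) ≡ B ^ e
      right-half = if-cong-then (≤ᵇ-true (≡.subst (suc (toℕ u) ≤_) (≡.sym p≡1+i) (s≤s u≤i)))
        (λ _ → cong (B ^_) (≡.trans (expoAt-punchIn-above i (toℕ u) (≤-reflexive (≡.sym u≡v))) (cong (expoAt g i) u≡v)))

      left-half : F u ≡ A ^ e
      left-half = if-cong-then (≤ᵇ-true (≡.subst₂ _≤_ (≡.sym j≡u) (≡.sym p≡1+i) (≤-trans u≤i (n≤1+n _))))
        (λ _ → cong₂ _^_ (cong (X p) (toℕ-injective (≡.trans j≡u (≡.sym (toℕ-inject₁ u)))))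
                         (≡.trans (cong (expoAt π p) j≡u)
                           (≡.trans (expoAt-punchIn-below i (toℕ u) (≤-reflexive u≡v)) (cong (expoAt g i) u≡v))))
        where
          j≡u : toℕ (punchIn (suc u) u) ≡ toℕ u
          j≡u = toℕ-punchIn-below (suc u) u (n<1+n (toℕ u))

      merged-cell : cell X′ g i u ≡ (t * (A * B)) ^ e
      merged-cell = if-cong-then (≤ᵇ-true u≤i) (λ _ → cong₂ _^_ (R1-merged i u v<n u≡v) (cong (expoAt g i) u≡v))

      merged : (cell X π p (suc u) * t ^ e) * F u ≈ cell X′ g i u
      merged = begin
        (cell X π p (suc u) * t ^ e) * F u  ≡⟨ cong₂ (λ x y → (x * t ^ e) * y) right-half left-half ⟩
        (B ^ e * t ^ e) * A ^ e             ≈⟨ x∙yz≈zx∙y (t ^ e) (A ^ e) (B ^ e) ⟨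
        t ^ e * (A ^ e * B ^ e)             ≈⟨ *-congˡ (^-distrib-* A B e) ⟨
        t ^ e * (A * B) ^ e                 ≈⟨ ^-distrib-* t (A * B) e ⟨
        (t * (A * B)) ^ e                   ≡⟨ merged-cell ⟨
        cell X′ g i u                       ∎

      unmerged : ∀ c → c ≢ u → F c ≡ cell X′ g i c
      unmerged c c≢u with punchInView (suc u) c
      ... | below c<1+u j≡c = if-cong-then (≡.trans (≤ᵇ-true c≤p) (≡.sym (≤ᵇ-true c≤i)))
                                (λ _ → entry-left i c _ j≡c c<v)
        where
          c<v : toℕ c < toℕ v
          c<v = ≡.subst (toℕ c <_) u≡v (≤∧≢⇒< (≤-pred c<1+u) (c≢u ∘ toℕ-injective))
          c≤i : toℕ c ≤ toℕ i
          c≤i = ≤-trans (<⇒≤ c<v) v≤i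
          c≤p : toℕ (punchIn (suc u) c) ≤ toℕ p
          c≤p = ≡.subst₂ _≤_ (≡.sym j≡c) (≡.sym p≡1+i) (≤-trans c≤i (n≤1+n _))
      ... | above 1+u≤c j≡1+c = if-cong-then (≡.trans (cong₂ _≤ᵇ_ j≡1+c p≡1+i) (≤ᵇ-cong {suc (toℕ c)} {suc (toℕ i)} (mk⇔ ≤-pred s≤s)))
                                (λ _ → entry-right i c _ j≡1+c v<n (≡.subst (_< toℕ c) u≡v 1+u≤c))

      row-right : row X π (punchIn v i) * t ^ headShare i ≈ row X′ g i
      row-right = begin
        row X π p * t ^ headShare i          ≈⟨ *-cong (RΠ.∑-punchIn (suc u) (cell X π p)) (≡⇒≈ (cong (t ^_) share≡e)) ⟩
        (cell X π p (suc u) * ΠF F) * t ^ e  ≈⟨ xy∙z≈xz∙y _ _ _ ⟩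
        (cell X π p (suc u) * t ^ e) * ΠF F  ≈⟨ RΠ.∑-update u _ F (cell X′ g i) merged (λ c c≢u → ≡⇒≈ (unmerged c c≢u)) ⟩
        row X′ g i                           ∎

    row-consLift : ∀ i → row X π (punchIn v i) * t ^ headShare i ≈ row X′ g i
    row-consLift i with punchInView v i
    ... | below i<v p≡i   = row-left i i<v p≡i
    ... | above v≤i p≡1+i = AboveRow.row-right i v≤i p≡1+i

    prefactor-pivot : Injective _≡_ _≡_ g → row X π v ≈ prefactor X v
    prefactor-pivot g-inj = RΠ.∑-cong λ j → ≡⇒≈ (if-cong-then refl λ j≤v →
      cong (X v j ^_) (expoAt-pivot g-inj (toℕ j) (≤ᵇ⇒≤ _ _ j≤v)))

    weight-consLift : Injective _≡_ _≡_ g → weight t X π ≈ prefactor X v * weight t X′ g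
    weight-consLift g-inj = begin
      t ^ N231 π * ΠF (row X π)
        ≈⟨ *-cong (≡⇒≈ (cong (t ^_) N231-consLift)) (RΠ.∑-punchIn v (row X π)) ⟩
      t ^ (N231-head v g ℕ.+ N231 g) * (row X π v * ΠF Q)
        ≈⟨ *-cong (^-+ t (N231-head v g) (N231 g)) (*-congʳ (prefactor-pivot g-inj)) ⟩
      (t ^ N231-head v g * t ^ N231 g) * (prefactor X v * ΠF Q)
        ≈⟨ rearrange (t ^ N231-head v g) (t ^ N231 g) (prefactor X v) (ΠF Q) ⟩
      prefactor X v * (t ^ N231 g * (ΠF Q * t ^ N231-head v g))
        ≈⟨ *-congˡ (*-congˡ (*-congˡ t^head)) ⟩
      prefactor X v * (t ^ N231 g * (ΠF Q * ΠF (λ i → t ^ headShare i)))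
        ≈⟨ *-congˡ (*-congˡ (RΠ.fold-∙ Q (λ i → t ^ headShare i) (allFin n))) ⟨
      prefactor X v * (t ^ N231 g * ΠF (λ i → Q i * t ^ headShare i))
        ≈⟨ *-congˡ (*-congˡ (RΠ.∑-cong row-consLift)) ⟩
      prefactor X v * (t ^ N231 g * ΠF (row X′ g)) ∎
      where
        Q : Fin n → Carrier
        Q i = row X π (punchIn v i)
        t^head : t ^ N231-head v g ≈ ΠF (λ i → t ^ headShare i)
        t^head = ≈-trans (≡⇒≈ (cong (t ^_) N231-head-by-rows)) (^-∑ t headShare)
        rearrange : ∀ a b p q → (a * b) * (p * q) ≈ p * (b * (q * a))
        rearrange a b p q = ≈-trans (xy∙z≈z∙yx a b (p * q)) (≈-trans (*-assoc p q (b * a)) (*-congˡ (x∙yz≈y∙xz q b a)))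

    summand-consLift : summand t X π ≈ prefactor X v * summand t X′ g
    summand-consLift rewrite isPerm-consLift v g with isPerm g in g-perm
    ... | true  = weight-consLift (to (isPerm⇔injective g) (from T-≡ g-perm))
      where open Equivalence
    ... | false = ≈-sym (zeroʳ _)

  open SumOverFunctions +-commutativeMonoid

  P-expansion : ∀ n t (X : Matrix (suc n)) → P (suc n) t X ≈ ΣF (λ v → prefactor X v * P n t (R1 t X v))
  P-expansion n t X = begin
    P (suc n) t X
      ≈⟨ ∑-allFuns-suc n (suc n) (summand t X) ⟩
    ΣF (λ v → RΣ.fold (map (summand t X ∘ consF v) (allFuns n (suc n))))
      ≈⟨ RΣ.∑-cong (λ v → ∑-allFuns-avoiding n v (summand t X ∘ consF v) (repeat-vanishes v)) ⟩
    ΣF (λ v → RΣ.fold (map (summand t X ∘ consLift v) (allFuns n n)))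
      ≈⟨ RΣ.∑-cong (λ v → RΣ.fold-cong (allFuns n n) (ConsLiftWeight.summand-consLift t X v)) ⟩
    ΣF (λ v → RΣ.fold (map (λ g → prefactor X v * summand t (R1 t X v) g) (allFuns n n)))
      ≈⟨ RΣ.∑-cong (λ v → *-distribˡ-fold (prefactor X v) (summand t (R1 t X v)) (allFuns n n)) ⟨
    ΣF (λ v → prefactor X v * P n t (R1 t X v)) ∎
    where
      repeat-vanishes : ∀ v f a → f a ≡ v → summand t X (consF v f) ≈ 0#
      repeat-vanishes v f a fa≡v = ≡⇒≈ (cong (if_then weight t X (consF v f) else 0#) (isPerm-repeat v f a fa≡v))

mainTheorem6 : ∀ {c ℓ} (R : CommutativeRing c ℓ) (n : ℕ)
    (t : CommutativeRing.Carrier R) (X : WithRing.Matrix R (suc n)) →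
    CommutativeRing._≈_ R (WithRing.P R (suc n) t X)
      (WithRing.ΣF R (λ i → CommutativeRing._*_ R (WithRing.prefactor R X i)
                               (WithRing.P R n t (WithRing.R1 R t X i))))
mainTheorem6 R = Weights.P-expansion R
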